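{- Let $k,d$ be nonnegative integers. If $T$ is a type of binary structure of size $k$ and depth $d$, then there is a constant $C_k$ depending only on $k$ such that for all positive integers $n_1,n_2$, \[ f(n_1,n_2,\{T\})\le C_k\,(n_1+n_2)^{d}. \]
   Context: Top splitting level: for a set $S$ of at least two nonnegative integers, $\ell(S)$ is the largest nonnegative integer $\ell$ such that $\{\lfloor 2^{ -\ell}s\rfloor : s\in S\}$ has at least two elements; $S_{\mathrm{Left}}$ is the set of $s\in S$ with $\lfloor 2^{ -\ell(S)}s\rfloor$ even, $S_{\mathrm{Right}}$ those with it odd. Binary structure: $b(S)$ is the weighted rooted ordered binary tree defined recursively: if $|S|=1$ it is a single root of weight $1$; if $|S|>1$ the root has weight $|S|$, left subtree $b(S_{\mathrm{Left}})$ and right subtree $b(S_{\mathrm{Right}})$. $b(S)$ is increasing if the right subtree of every internal node is a single vertex, and decreasing if the left subtree of every internal node is a single vertex. A type of binary structure $T$ is a weighted rooted ordered binary tree whose leaves have positive integer weights and each internal vertex has weight equal to the sum of its children's weights; its size is the root weight. A set $S$ is of type $T$ if $T$ can be obtained from $b(S)$ by iteratively removing leaves (keeping the weights of remaining vertices). The depth of a binary tree is the number of edges on a longest root-to-leaf path. For positive integers $n_1,n_2$ and a family $\mathcal T$ of types, $f(n_1,n_2,\mathcal T)$ is the maximum size of a set $S$ of nonnegative integers containing no $n_1$-subset with increasing binary structure, no $n_2$-subset with decreasing binary structure, and no subset of type $T$ for any $T\in\mathcal T$. -}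

module Defs where

open import Data.Nat using (ℕ; zero; suc; _+_; _*_; _^_; _≤_; _<_; _⊔_; _/_; _%_; _≡ᵇ_)
open import Data.Nat.Properties using (m^n≢0)
open import Data.List using (List; []; _∷_; length; filterᵇ)
open import Data.List.Membership.Propositional using (_∈_)
open import Data.List.Relation.Unary.Unique.Propositional using (Unique)
open import Data.List.Relation.Binary.Subset.Propositional using (_⊆_)
open import Data.Bool using (Bool; not)
open import Data.Product using (Σ; ∃; ∃-syntax; _×_; _,_)
open import Relation.Binary.PropositionalEquality using (_≡_; _≢_)
open import Relation.Nullary using (¬_)
open import Data.Unit using (⊤)
open import Data.Empty using (⊥)

-- Finite sets of nonnegative integers are represented by duplicate-free lists
-- (the order of the list is irrelevant for all notions below).

shiftDown : ℕ → ℕ → ℕ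
shiftDown ℓ s = _/_ s (2 ^ ℓ) {{m^n≢0 2 ℓ}}

SplitsAt : List ℕ → ℕ → Set
SplitsAt S ℓ = ∃[ a ] ∃[ b ] (a ∈ S × b ∈ S × shiftDown ℓ a ≢ shiftDown ℓ b)

TopLevel : List ℕ → ℕ → Set
TopLevel S ℓ = SplitsAt S ℓ × (∀ m → ℓ < m → ¬ SplitsAt S m)

isEvenᵇ : ℕ → Bool
isEvenᵇ n = (n % 2) ≡ᵇ 0

leftPart : ℕ → List ℕ → List ℕ
leftPart ℓ S = filterᵇ (λ s → isEvenᵇ (shiftDown ℓ s)) S

rightPart : ℕ → List ℕ → List ℕ
rightPart ℓ S = filterᵇ (λ s → not (isEvenᵇ (shiftDown ℓ s))) S

data WTree : Set where
  vtx : ℕ → WTree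
  br  : ℕ → WTree → WTree → WTree

weight : WTree → ℕ
weight (vtx w)    = w
weight (br w _ _) = w

depth : WTree → ℕ
depth (vtx _)    = 0
depth (br _ l r) = suc (depth l ⊔ depth r)

-- IsB S t : t is the binary structure b(S)  (b is defined recursively;
-- we render it as its graph, which is a functional relation).
data IsB : List ℕ → WTree → Set where
  single : ∀ x → IsB (x ∷ []) (vtx 1)
  split  : ∀ {S l r} ℓ → 2 ≤ length S → TopLevel S ℓ →
           IsB (leftPart ℓ S) l → IsB (rightPart ℓ S) r →
           IsB S (br (length S) l r)

Increasing : WTree → Set
Increasing (vtx _)          = ⊤
Increasing (br _ l (vtx _)) = Increasing l
Increasing (br _ l (br _ _ _)) = ⊥

Decreasing : WTree → Set
Decreasing (vtx _)          = ⊤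
Decreasing (br _ (vtx _) r) = Decreasing r
Decreasing (br _ (br _ _ _) r) = ⊥

IsType : WTree → Set
IsType (vtx w)    = 1 ≤ w
IsType (br w l r) = (w ≡ weight l + weight r) × IsType l × IsType r

size : WTree → ℕ
size = weight

-- Prune t T : T is obtained from t by iteratively removing leaves, keeping
-- the weights of the remaining vertices (i.e. T is a rooted top part of t).
data Prune : WTree → WTree → Set where
  cut  : ∀ t → Prune t (vtx (weight t))
  keep : ∀ {w l r l' r'} → Prune l l' → Prune r r' → Prune (br w l r) (br w l' r')

OfType : List ℕ → WTree → Set
OfType S T = ∃[ t ] (IsB S t × Prune t T)

HasIncreasingStructure : List ℕ → Set
HasIncreasingStructure S = ∃[ t ] (IsB S t × Increasing t)

HasDecreasingStructure : List ℕ → Set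
HasDecreasingStructure S = ∃[ t ] (IsB S t × Decreasing t)

Avoids : ℕ → ℕ → WTree → List ℕ → Set
Avoids n₁ n₂ T S =
  (∀ S' → Unique S' → S' ⊆ S → length S' ≡ n₁ → ¬ HasIncreasingStructure S') ×
  (∀ S' → Unique S' → S' ⊆ S → length S' ≡ n₂ → ¬ HasDecreasingStructure S') ×
  (∀ S' → Unique S' → S' ⊆ S → ¬ OfType S' T)

{-# OPTIONS --safe #-}
module Submission where

-- Induction on T, with constant C = size T.  A set avoiding a leaf of weight k
-- has fewer than k elements.  For T = br k L R let M bound the sets avoiding L
-- or R.  A subset X of S whose two top-level parts both exceed M would contain a
-- copy of L on the left and of R on the right, and these join to a copy of T;
-- so in every subset one top-level part has at most M elements.  Walk from S
-- into the larger part: a step to the right part can be prefixed by an element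
-- of the left part, so it lowers the admissible size of decreasing structures
-- by one, and symmetrically a step to the left lowers that of increasing
-- structures.  Hence fewer than n₁ + n₂ steps are possible, each discarding at
-- most M elements, and |S| ≤ 1 + (n₁ + n₂) M ≤ k (n₁ + n₂)^(depth T).

open import Defs
open import Data.Bool using (Bool; true; false; not; T)
open import Data.Bool.Properties using (T?)
open import Data.Empty using (⊥-elim)
open import Data.List using (List; []; _∷_; _++_; length; take; drop)
open import Data.List.Extrema.Nat using (max; xs≤max)
open import Data.List.Membership.Propositional using (_∈_; find)
open import Data.List.Membership.Propositional.Properties using (∈-filter⁺; ∈-filter⁻; ∈-length; ∈-++⁺ˡ; ∈-++⁺ʳ; ∈-++⁻)
open import Data.List.Properties using (filter-++; filter-all; filter-none; length-++; length-take; take++drop≡id; ++-identityʳ)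
open import Data.List.Relation.Binary.Subset.Propositional using (_⊆_)
open import Data.List.Relation.Binary.Subset.Propositional.Properties using (⊆-refl; xs⊆xs++ys)
open import Data.List.Relation.Unary.All as All using ([]; _∷_; all?)
open import Data.List.Relation.Unary.AllPairs using ([]; _∷_)
open import Data.List.Relation.Unary.All.Properties using (¬All⇒Any¬)
open import Data.List.Relation.Unary.Any using (here; there)
open import Data.List.Relation.Unary.Unique.Propositional using (Unique)
import Data.List.Relation.Unary.Unique.Propositional.Properties as Unique
open import Data.Nat using (ℕ; zero; suc; _+_; _*_; _^_; _≤_; _<_; _⊔_; _/_; _%_; _≡ᵇ_; _≟_; _≤?_; z≤n; s≤s; z<s)
open import Data.Nat.DivMod using (m/n/o≡m/[n*o]; /-congʳ; m≡m%n+[m/n]*n; m%n<n; n/1≡n; m<n⇒m/n≡0)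
open import Data.Nat.Induction using (<-wellFounded)
open import Data.Nat.Properties
open import Algebra.Properties.CommutativeSemigroup *-commutativeSemigroup using (x∙yz≈y∙xz)
open import Data.Product using (∃; ∃₂; ∃-syntax; _×_; _,_; proj₁; proj₂)
open import Data.Sum using (_⊎_; inj₁; inj₂; [_,_])
open import Data.Unit using (tt)
open import Function using (_∘_)
open import Induction.WellFounded using (Acc; acc)
open import Relation.Binary.PropositionalEquality using (_≡_; _≢_; refl; sym; trans; cong; cong₂; subst; module ≡-Reasoning)
open import Relation.Nullary using (Dec; yes; no; ¬_; decidable-stable)

private variable
  ℓ k M : ℕ
  a b x : ℕ
  S A B : List ℕ
  t t′ tA tB L R : WTree

n<2^n : ∀ n → n < 2 ^ n
n<2^n zero    = z<s
n<2^n (suc n) = begin-strict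
  suc n           <⟨ +-monoʳ-< 1 (n<2^n n) ⟩
  1 + 2 ^ n       ≤⟨ +-monoˡ-≤ (2 ^ n) (m^n>0 2 n) ⟩
  2 ^ n + 2 ^ n   ≡⟨ cong (2 ^ n +_) (sym (+-identityʳ (2 ^ n))) ⟩
  2 ^ suc n       ∎
  where open ≤-Reasoning

bit-injective : a < 2 → b < 2 → (a ≡ᵇ 0) ≡ (b ≡ᵇ 0) → a ≡ b
bit-injective {0} {0} _ _ _ = refl
bit-injective {1} {1} _ _ _ = refl
bit-injective {0} {1} _ _ ()
bit-injective {1} {0} _ _ ()
bit-injective {suc (suc _)} (s≤s (s≤s ())) _ _
bit-injective {_} {suc (suc _)} _ (s≤s (s≤s ())) _

half-and-parity-injective : ∀ u v → u / 2 ≡ v / 2 → isEvenᵇ u ≡ isEvenᵇ v → u ≡ v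
half-and-parity-injective u v halves parities = begin
  u                   ≡⟨ m≡m%n+[m/n]*n u 2 ⟩
  u % 2 + u / 2 * 2   ≡⟨ cong₂ (λ r q → r + q * 2) (bit-injective (m%n<n u 2) (m%n<n v 2) parities) halves ⟩
  v % 2 + v / 2 * 2   ≡⟨ sym (m≡m%n+[m/n]*n v 2) ⟩
  v                   ∎
  where open ≡-Reasoning

m⊔n<m+n : ∀ m n → 0 < m → 0 < n → m ⊔ n < m + n
m⊔n<m+n (suc m) (suc n) _ _ = s≤s (begin
  suc (m ⊔ n)   ≤⟨ s≤s (m⊔n≤m+n m n) ⟩
  suc (m + n)   ≡⟨ sym (+-suc m n) ⟩
  m + suc n     ∎)
  where open ≤-Reasoning

m<n⇒1+m*o≤n*o : ∀ {m n o} → 0 < o → m < n → 1 + m * o ≤ n * o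
m<n⇒1+m*o≤n*o {m} {n} {o} 0<o m<n = ≤-trans (+-monoˡ-≤ (m * o) 0<o) (*-monoˡ-≤ o m<n)

T-not⇒¬T : ∀ {p} → T (not p) → ¬ T p
T-not⇒¬T {true} ()

T⇒¬T-not : ∀ {p} → T p → ¬ T (not p)
T⇒¬T-not {true} _ ()

-- Splitting levels

evenAt : ℕ → ℕ → Bool
evenAt ℓ s = isEvenᵇ (shiftDown ℓ s)

shiftDown-suc : ∀ ℓ s → shiftDown (suc ℓ) s ≡ shiftDown ℓ s / 2
shiftDown-suc ℓ s = sym (trans
  (m/n/o≡m/[n*o] s (2 ^ ℓ) 2 {{m^n≢0 2 ℓ}} {{_}} {{m*n≢0 (2 ^ ℓ) 2 {{m^n≢0 2 ℓ}}}})
  (/-congʳ {{m*n≢0 (2 ^ ℓ) 2 {{m^n≢0 2 ℓ}}}} {{m^n≢0 2 (suc ℓ)}} (*-comm (2 ^ ℓ) 2)))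

splitsAt? : ∀ S ℓ → Dec (SplitsAt S ℓ)
splitsAt? []      ℓ = no λ ()
splitsAt? (x ∷ S) ℓ with all? (λ b → shiftDown ℓ b ≟ shiftDown ℓ x) (x ∷ S)
... | yes same = no λ (a , b , a∈ , b∈ , a≉b) →
  a≉b (trans (All.lookup same a∈) (sym (All.lookup same b∈)))
... | no ¬same with b , b∈ , b≉x ← find (¬All⇒Any¬ (λ b → shiftDown ℓ b ≟ shiftDown ℓ x) _ ¬same) =
  yes (b , x , b∈ , here refl , b≉x)

¬splitsAt⇒≡ : ¬ SplitsAt S ℓ → a ∈ S → b ∈ S → shiftDown ℓ a ≡ shiftDown ℓ b
¬splitsAt⇒≡ ¬split a∈ b∈ = decidable-stable (_ ≟ _) λ a≉b → ¬split (_ , _ , a∈ , b∈ , a≉b)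

splitsAt⇒2≤length : SplitsAt S ℓ → 2 ≤ length S
splitsAt⇒2≤length {_ ∷ _ ∷ _} _                                     = s≤s (s≤s z≤n)
splitsAt⇒2≤length {_ ∷ []}    (_ , _ , here refl , here refl , a≉b) = ⊥-elim (a≉b refl)
splitsAt⇒2≤length {_ ∷ []}    (_ , _ , there () , _)
splitsAt⇒2≤length {_ ∷ []}    (_ , _ , _ , there () , _)

splitsAt-0 : a ∈ S → b ∈ S → a ≢ b → SplitsAt S 0
splitsAt-0 {a} {b = b} a∈ b∈ a≢b = a , b , a∈ , b∈ , λ eq → a≢b (trans (sym (n/1≡n a)) (trans eq (n/1≡n b)))

¬splitsAt-above-max : max 0 S ≤ ℓ → ¬ SplitsAt S ℓ
¬splitsAt-above-max {S} {ℓ} max≤ℓ (a , b , a∈ , b∈ , a≉b) = a≉b (trans (vanishes a∈) (sym (vanishes b∈)))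
  where
  vanishes : x ∈ S → shiftDown ℓ x ≡ 0
  vanishes {x} x∈ = m<n⇒m/n≡0 {{m^n≢0 2 ℓ}}
    (<-≤-trans (n<2^n x) (^-monoʳ-≤ 2 (≤-trans (All.lookup (xs≤max 0 S) x∈) max≤ℓ)))

greatest-witness : {P : ℕ → Set} → (∀ m → Dec (P m)) → ∀ w → P w →
                   ∀ U → (∀ m → U ≤ m → ¬ P m) → ∃[ ℓ ] P ℓ × (∀ m → ℓ < m → ¬ P m)
greatest-witness P? w Pw zero    none = ⊥-elim (none _ z≤n Pw)
greatest-witness P? w Pw (suc U) none with P? U
... | yes PU = U , PU , none
... | no ¬PU = greatest-witness P? w Pw U λ m U≤m → case (m≤n⇒m<n∨m≡n U≤m)
  where
  case : ∀ {m} → U < m ⊎ U ≡ m → ¬ _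
  case (inj₁ U<m)  = none _ U<m
  case (inj₂ refl) = ¬PU

topLevel-exists : ∀ ℓ → SplitsAt S ℓ → ∃ (TopLevel S)
topLevel-exists {S} ℓ splits = greatest-witness (splitsAt? S) ℓ splits (max 0 S) λ m → ¬splitsAt-above-max {ℓ = m}

unique-topLevel : ∀ {zs} → Unique (a ∷ b ∷ zs) → ∃ (TopLevel (a ∷ b ∷ zs))
unique-topLevel ((a≢b ∷ _) ∷ _) = topLevel-exists 0 (splitsAt-0 (here refl) (there (here refl)) a≢b)

∈-leftPart⁻ : ∀ ℓ S → x ∈ leftPart ℓ S → x ∈ S × T (evenAt ℓ x)
∈-leftPart⁻ ℓ S = ∈-filter⁻ (T? ∘ evenAt ℓ) {xs = S}

∈-rightPart⁻ : ∀ ℓ S → x ∈ rightPart ℓ S → x ∈ S × T (not (evenAt ℓ x))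
∈-rightPart⁻ ℓ S = ∈-filter⁻ (T? ∘ not ∘ evenAt ℓ) {xs = S}

leftPart-⊆ : ∀ ℓ S → leftPart ℓ S ⊆ S
leftPart-⊆ ℓ S = proj₁ ∘ ∈-leftPart⁻ ℓ S

rightPart-⊆ : ∀ ℓ S → rightPart ℓ S ⊆ S
rightPart-⊆ ℓ S = proj₁ ∘ ∈-rightPart⁻ ℓ S

leftPart-unique : ∀ ℓ → Unique S → Unique (leftPart ℓ S)
leftPart-unique ℓ = Unique.filter⁺ (T? ∘ evenAt ℓ)

rightPart-unique : ∀ ℓ → Unique S → Unique (rightPart ℓ S)
rightPart-unique ℓ = Unique.filter⁺ (T? ∘ not ∘ evenAt ℓ)

length-parts : ∀ ℓ S → length (leftPart ℓ S) + length (rightPart ℓ S) ≡ length S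
length-parts ℓ []      = refl
length-parts ℓ (x ∷ S) with evenAt ℓ x
... | true  = cong suc (length-parts ℓ S)
... | false = trans (+-suc _ _) (cong suc (length-parts ℓ S))

-- Two elements separated at the top level ℓ agree at level ℓ + 1, i.e. after
-- halving, so only their parities at level ℓ can differ.
topLevel-parities-differ : TopLevel S ℓ → ∃₂ λ a b → a ∈ S × b ∈ S × evenAt ℓ a ≢ evenAt ℓ b
topLevel-parities-differ {S} {ℓ} ((a , b , a∈ , b∈ , a≉b) , top) =
  a , b , a∈ , b∈ , a≉b ∘ half-and-parity-injective _ _ (begin
    shiftDown ℓ a / 2      ≡⟨ sym (shiftDown-suc ℓ a) ⟩
    shiftDown (suc ℓ) a    ≡⟨ ¬splitsAt⇒≡ {ℓ = suc ℓ} (top (suc ℓ) ≤-refl) a∈ b∈ ⟩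
    shiftDown (suc ℓ) b    ≡⟨ shiftDown-suc ℓ b ⟩
    shiftDown ℓ b / 2      ∎)
  where open ≡-Reasoning

topLevel-parts-inhabited : TopLevel S ℓ → ∃ (_∈ leftPart ℓ S) × ∃ (_∈ rightPart ℓ S)
topLevel-parts-inhabited {S} {ℓ} top with a , b , a∈ , b∈ , a≠b ← topLevel-parities-differ top
  with evenAt ℓ a in ea | evenAt ℓ b in eb
... | true  | false = (a , ∈-filter⁺ (T? ∘ evenAt ℓ) a∈ (subst T (sym ea) tt))
                   , (b , ∈-filter⁺ (T? ∘ not ∘ evenAt ℓ) b∈ (subst (T ∘ not) (sym eb) tt))
... | false | true  = (b , ∈-filter⁺ (T? ∘ evenAt ℓ) b∈ (subst T (sym eb) tt))
                   , (a , ∈-filter⁺ (T? ∘ not ∘ evenAt ℓ) a∈ (subst (T ∘ not) (sym ea) tt))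
... | true  | true  = ⊥-elim (a≠b refl)
... | false | false = ⊥-elim (a≠b refl)

topLevel-leftPart< : TopLevel S ℓ → length (leftPart ℓ S) < length S
topLevel-leftPart< {S} {ℓ} top = subst (length (leftPart ℓ S) <_) (length-parts ℓ S)
  (m<m+n _ (∈-length (proj₂ (proj₂ (topLevel-parts-inhabited top)))))

topLevel-rightPart< : TopLevel S ℓ → length (rightPart ℓ S) < length S
topLevel-rightPart< {S} {ℓ} top = subst (length (rightPart ℓ S) <_) (length-parts ℓ S)
  (m<n+m _ (∈-length (proj₂ (proj₁ (topLevel-parts-inhabited top)))))

-- Binary structures

weight-isB : IsB S t → weight t ≡ length S
weight-isB (single _)        = refl
weight-isB (split _ _ _ _ _) = refl

weight-prune : Prune t t′ → weight t′ ≡ weight t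
weight-prune (cut _)    = refl
weight-prune (keep _ _) = refl

isType⇒0<weight : IsType t → 0 < weight t
isType⇒0<weight {vtx _}    0<w                = 0<w
isType⇒0<weight {br _ l _} (refl , typeL , _) = <-≤-trans (isType⇒0<weight typeL) (m≤m+n _ _)

isB-exists : Unique S → 0 < length S → ∃ (IsB S)
isB-exists = go (<-wellFounded _)
  where
  go : Acc _<_ (length S) → Unique S → 0 < length S → ∃ (IsB S)
  go {x ∷ []}        _         _ _ = vtx 1 , single x
  go {S@(_ ∷ _ ∷ _)} (acc rec) u _ with ℓ , top ← unique-topLevel u =
    let (a , a∈) , (b , b∈) = topLevel-parts-inhabited top
        l , isL = go (rec (topLevel-leftPart< top)) (leftPart-unique ℓ u) (∈-length a∈)
        r , isR = go (rec (topLevel-rightPart< top)) (rightPart-unique ℓ u) (∈-length b∈)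
    in br _ l r , split ℓ (s≤s (s≤s z≤n)) top isL isR

ofType-leaf : Unique S → 0 < length S → OfType S (vtx (length S))
ofType-leaf u 0<|S| with t , isB ← isB-exists u 0<|S| =
  t , isB , subst (Prune t ∘ vtx) (weight-isB isB) (cut t)

isB-inhabited : IsB S t → ∃ (_∈ S)
isB-inhabited (single x)                             = x , here refl
isB-inhabited (split _ _ ((a , _ , a∈ , _) , _) _ _) = a , a∈

module _ {S ℓ} (top : TopLevel S ℓ) {A B} (A⊆ : A ⊆ leftPart ℓ S) (B⊆ : B ⊆ rightPart ℓ S) where

  private
    evenA : x ∈ A → T (evenAt ℓ x)
    evenA x∈ = proj₂ (∈-leftPart⁻ ℓ S (A⊆ x∈))

    oddB : x ∈ B → T (not (evenAt ℓ x))
    oddB x∈ = proj₂ (∈-rightPart⁻ ℓ S (B⊆ x∈))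

  joined-⊆ : A ++ B ⊆ S
  joined-⊆ x∈ with ∈-++⁻ A x∈
  ... | inj₁ x∈A = leftPart-⊆ ℓ S (A⊆ x∈A)
  ... | inj₂ x∈B = rightPart-⊆ ℓ S (B⊆ x∈B)

  joined-unique : Unique A → Unique B → Unique (A ++ B)
  joined-unique uA uB = Unique.++⁺ uA uB λ (x∈A , x∈B) → T-not⇒¬T (oddB x∈B) (evenA x∈A)

  leftPart-joined : leftPart ℓ (A ++ B) ≡ A
  leftPart-joined = begin
    leftPart ℓ (A ++ B)                ≡⟨ filter-++ (T? ∘ evenAt ℓ) A B ⟩
    leftPart ℓ A ++ leftPart ℓ B       ≡⟨ cong₂ _++_ (filter-all (T? ∘ evenAt ℓ) (All.tabulate evenA))
                                                     (filter-none (T? ∘ evenAt ℓ) (All.tabulate (T-not⇒¬T ∘ oddB))) ⟩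
    A ++ []                            ≡⟨ ++-identityʳ A ⟩
    A                                  ∎
    where open ≡-Reasoning

  rightPart-joined : rightPart ℓ (A ++ B) ≡ B
  rightPart-joined = begin
    rightPart ℓ (A ++ B)               ≡⟨ filter-++ (T? ∘ not ∘ evenAt ℓ) A B ⟩
    rightPart ℓ A ++ rightPart ℓ B     ≡⟨ cong₂ _++_ (filter-none (T? ∘ not ∘ evenAt ℓ) (All.tabulate λ x∈ → T⇒¬T-not (evenA x∈)))
                                                     (filter-all (T? ∘ not ∘ evenAt ℓ) (All.tabulate oddB)) ⟩
    B                                  ∎
    where open ≡-Reasoning

  joined-topLevel : a ∈ A → b ∈ B → TopLevel (A ++ B) ℓ
  joined-topLevel {a} {b} a∈ b∈ = splits , above
    where
    splits : SplitsAt (A ++ B) ℓ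
    splits = a , b , ∈-++⁺ˡ a∈ , ∈-++⁺ʳ A b∈ , λ eq → T-not⇒¬T (oddB b∈) (subst (T ∘ isEvenᵇ) eq (evenA a∈))
    above : ∀ m → ℓ < m → ¬ SplitsAt (A ++ B) m
    above m ℓ<m (a′ , b′ , a′∈ , b′∈ , a′≉b′) = proj₂ top m ℓ<m (a′ , b′ , joined-⊆ a′∈ , joined-⊆ b′∈ , a′≉b′)

  joined-isB : IsB A tA → IsB B tB → IsB (A ++ B) (br (length (A ++ B)) tA tB)
  joined-isB isA isB = split ℓ (splitsAt⇒2≤length {ℓ = ℓ} (proj₁ top′)) top′
    (subst (λ X → IsB X _) (sym leftPart-joined) isA)
    (subst (λ X → IsB X _) (sym rightPart-joined) isB)
    where
    top′ : TopLevel (A ++ B) ℓ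
    top′ = joined-topLevel (proj₂ (isB-inhabited isA)) (proj₂ (isB-inhabited isB))

  joined-ofType : OfType A L → OfType B R → OfType (A ++ B) (br (weight L + weight R) L R)
  joined-ofType {L} {R} (tA , isA , pruneA) (tB , isB , pruneB) =
    br _ tA tB , joined-isB isA isB ,
    subst (λ w → Prune (br (length (A ++ B)) tA tB) (br w L R)) size≡ (keep pruneA pruneB)
    where
    size≡ : length (A ++ B) ≡ weight L + weight R
    size≡ = trans (length-++ A) (sym (cong₂ _+_ (trans (weight-prune pruneA) (weight-isB isA))
                                               (trans (weight-prune pruneB) (weight-isB isB))))

AllSubsets : (List ℕ → Set) → List ℕ → Set
AllSubsets P S = ∀ S′ → Unique S′ → S′ ⊆ S → P S′

AllSubsets-⊆ : ∀ {P} → A ⊆ S → AllSubsets P S → AllSubsets P A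
AllSubsets-⊆ A⊆S all S′ u S′⊆A = all S′ u (A⊆S ∘ S′⊆A)

NoIncreasing : ℕ → List ℕ → Set
NoIncreasing n = AllSubsets λ S′ → length S′ ≡ n → ¬ HasIncreasingStructure S′

NoDecreasing : ℕ → List ℕ → Set
NoDecreasing n = AllSubsets λ S′ → length S′ ≡ n → ¬ HasDecreasingStructure S′

NoSubsetOfType : WTree → List ℕ → Set
NoSubsetOfType t = AllSubsets λ S′ → ¬ OfType S′ t

singleton-⊆ : x ∈ S → x ∷ [] ⊆ S
singleton-⊆ x∈ (here refl) = x∈

¬noIncreasing-1 : ¬ NoIncreasing 1 (x ∷ S)
¬noIncreasing-1 {x} noInc = noInc (x ∷ []) ([] ∷ []) (singleton-⊆ (here refl)) refl (vtx 1 , single x , tt)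

¬noDecreasing-1 : ¬ NoDecreasing 1 (x ∷ S)
¬noDecreasing-1 {x} noDec = noDec (x ∷ []) ([] ∷ []) (singleton-⊆ (here refl)) refl (vtx 1 , single x , tt)

noIncreasing-leftPart : ∀ {p} → TopLevel S ℓ → b ∈ rightPart ℓ S →
                        NoIncreasing (suc p) S → NoIncreasing p (leftPart ℓ S)
noIncreasing-leftPart {S} {ℓ} {b} top b∈ noInc D uD D⊆ refl (t , isB , inc) =
  noInc (D ++ b ∷ []) (joined-unique top D⊆ [b]⊆ uD ([] ∷ [])) (joined-⊆ top D⊆ [b]⊆)
        (trans (length-++ D) (+-comm (length D) 1))
        (br _ t (vtx 1) , joined-isB top D⊆ [b]⊆ isB (single b) , inc)
  where [b]⊆ = singleton-⊆ b∈

noDecreasing-rightPart : ∀ {q} → TopLevel S ℓ → a ∈ leftPart ℓ S →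
                         NoDecreasing (suc q) S → NoDecreasing q (rightPart ℓ S)
noDecreasing-rightPart {S} {ℓ} {a} top a∈ noDec D uD D⊆ refl (t , isB , dec) =
  noDec (a ∷ D) (joined-unique top [a]⊆ D⊆ ([] ∷ []) uD) (joined-⊆ top [a]⊆ D⊆) refl
        (br _ (vtx 1) t , joined-isB top [a]⊆ D⊆ (single a) isB , dec)
  where [a]⊆ = singleton-⊆ a∈

-- Walking down into the larger part

Unbalanced : ℕ → List ℕ → Set
Unbalanced M = AllSubsets λ X → ∀ {ℓ} → TopLevel X ℓ →
  length (leftPart ℓ X) ≤ M ⊎ length (rightPart ℓ X) ≤ M

unbalanced-bound : ∀ p q → Unique S → Unbalanced M S →
                   NoIncreasing (suc p) S → NoDecreasing (suc q) S →
                   length S ≤ suc ((suc p + suc q) * M)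
unbalanced-bound {[]}          _       _       _ _ _     _     = z≤n
unbalanced-bound {_ ∷ []}      _       _       _ _ _     _     = s≤s z≤n
unbalanced-bound {_ ∷ _ ∷ _}   zero    _       _ _ noInc _     = ⊥-elim (¬noIncreasing-1 noInc)
unbalanced-bound {_ ∷ _ ∷ _}   (suc p) zero    _ _ _     noDec = ⊥-elim (¬noDecreasing-1 noDec)
unbalanced-bound {S@(_ ∷ _ ∷ _)} {M} (suc p) (suc q) u unb noInc noDec
  with ℓ , top ← unique-topLevel u = [ leftSmall , rightSmall ] (unb S u ⊆-refl top)
  where
  open ≤-Reasoning
  Sₗ = leftPart ℓ S
  Sᵣ = rightPart ℓ S

  leftSmall : length Sₗ ≤ M → length S ≤ suc ((suc (suc p) + suc (suc q)) * M)
  leftSmall Sₗ≤M = begin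
    length S                                ≡⟨ sym (length-parts ℓ S) ⟩
    length Sₗ + length Sᵣ                   ≤⟨ +-mono-≤ Sₗ≤M Sᵣ≤ ⟩
    M + suc ((suc (suc p) + suc q) * M)     ≡⟨ +-suc M _ ⟩
    suc (suc (suc (suc p) + suc q) * M)     ≡⟨ cong (λ n → suc (n * M)) (sym (+-suc (suc (suc p)) (suc q))) ⟩
    suc ((suc (suc p) + suc (suc q)) * M)   ∎
    where
    Sᵣ≤ : length Sᵣ ≤ suc ((suc (suc p) + suc q) * M)
    Sᵣ≤ = unbalanced-bound (suc p) q (rightPart-unique ℓ u) (AllSubsets-⊆ (rightPart-⊆ ℓ S) unb)
           (AllSubsets-⊆ (rightPart-⊆ ℓ S) noInc)
           (noDecreasing-rightPart top (proj₂ (proj₁ (topLevel-parts-inhabited top))) noDec)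

  rightSmall : length Sᵣ ≤ M → length S ≤ suc ((suc (suc p) + suc (suc q)) * M)
  rightSmall Sᵣ≤M = begin
    length S                                ≡⟨ sym (length-parts ℓ S) ⟩
    length Sₗ + length Sᵣ                   ≤⟨ +-mono-≤ Sₗ≤ Sᵣ≤M ⟩
    suc ((suc p + suc (suc q)) * M) + M     ≡⟨ cong suc (+-comm _ M) ⟩
    suc ((suc (suc p) + suc (suc q)) * M)   ∎
    where
    Sₗ≤ : length Sₗ ≤ suc ((suc p + suc (suc q)) * M)
    Sₗ≤ = unbalanced-bound p (suc q) (leftPart-unique ℓ u) (AllSubsets-⊆ (leftPart-⊆ ℓ S) unb)
           (noIncreasing-leftPart top (proj₂ (proj₂ (topLevel-parts-inhabited top))) noInc)
           (AllSubsets-⊆ (leftPart-⊆ ℓ S) noDec)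

children-bounded⇒unbalanced : ∀ {n₁ n₂} →
  (∀ {X} → Unique X → Avoids n₁ n₂ L X → length X ≤ M) →
  (∀ {X} → Unique X → Avoids n₁ n₂ R X → length X ≤ M) →
  Avoids n₁ n₂ (br (weight L + weight R) L R) S → Unbalanced M S
children-bounded⇒unbalanced {L} {M} {R} {S} {n₁} {n₂} boundL boundR (noInc , noDec , noT) X uX X⊆S {ℓ} top
  with length (leftPart ℓ X) ≤? M
... | yes Xₗ≤M = inj₁ Xₗ≤M
... | no  Xₗ≰M = inj₂ (≮⇒≥ λ M<Xᵣ →
  contains boundL (leftPart-unique ℓ uX) (leftPart-⊆ ℓ X) (≰⇒> Xₗ≰M) λ A uA A⊆ ofL →
  contains boundR (rightPart-unique ℓ uX) (rightPart-⊆ ℓ X) M<Xᵣ λ B uB B⊆ ofR →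
  noT (A ++ B) (joined-unique top A⊆ B⊆ uA uB) (X⊆S ∘ joined-⊆ top A⊆ B⊆) (joined-ofType top A⊆ B⊆ ofL ofR))
  where
  contains : ∀ {C Y} → (∀ {X} → Unique X → Avoids n₁ n₂ C X → length X ≤ M) →
             Unique Y → Y ⊆ X → M < length Y → ¬ NoSubsetOfType C Y
  contains bound uY Y⊆X M<Y noC = <⇒≱ M<Y
    (bound uY (AllSubsets-⊆ (X⊆S ∘ Y⊆X) noInc , AllSubsets-⊆ (X⊆S ∘ Y⊆X) noDec , noC))

take-⊆ : ∀ n (xs : List ℕ) → take n xs ⊆ xs
take-⊆ n xs = subst (take n xs ⊆_) (take++drop≡id n xs) (xs⊆xs++ys (take n xs) (drop n xs))

noSubsetOfType-leaf : 0 < k → Unique S → NoSubsetOfType (vtx k) S → length S < k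
noSubsetOfType-leaf {k} {S} 0<k u noT = ≰⇒> λ k≤|S| →
  let |take|≡k = trans (length-take k S) (m≤n⇒m⊓n≡m k≤|S|)
      uTake    = Unique.take⁺ k u
  in noT (take k S) uTake (take-⊆ k S)
       (subst (OfType (take k S) ∘ vtx) |take|≡k (ofType-leaf uTake (subst (0 <_) (sym |take|≡k) 0<k)))

avoiding-bound : ∀ t → IsType t → ∀ {n₁ n₂} → 1 ≤ n₁ → 1 ≤ n₂ →
                 Unique S → Avoids n₁ n₂ t S → length S ≤ size t * (n₁ + n₂) ^ depth t
avoiding-bound (vtx k) 0<k _ _ u (_ , _ , noT) =
  ≤-trans (<⇒≤ (noSubsetOfType-leaf 0<k u noT)) (≤-reflexive (sym (*-identityʳ k)))
avoiding-bound {S} (br k L R) (refl , typeL , typeR) {suc p} {suc q} 1≤n₁ 1≤n₂ u avoid@(noInc , noDec , _) =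
  begin
    length S                ≤⟨ unbalanced-bound p q u (children-bounded⇒unbalanced boundL boundR avoid) noInc noDec ⟩
    suc (N * (w * N ^ e))   ≡⟨ cong suc (x∙yz≈y∙xz N w (N ^ e)) ⟩
    suc (w * N ^ suc e)     ≤⟨ m<n⇒1+m*o≤n*o (m^n>0 N (suc e)) (m⊔n<m+n _ _ (isType⇒0<weight typeL) (isType⇒0<weight typeR)) ⟩
    k * N ^ suc e           ∎
  where
  open ≤-Reasoning
  N = suc p + suc q
  e = depth L ⊔ depth R
  w = weight L ⊔ weight R

  boundL : ∀ {X} → Unique X → Avoids (suc p) (suc q) L X → length X ≤ w * N ^ e
  boundL uX avoidL = ≤-trans (avoiding-bound L typeL 1≤n₁ 1≤n₂ uX avoidL)
    (*-mono-≤ (m≤m⊔n (weight L) (weight R)) (^-monoʳ-≤ N (m≤m⊔n (depth L) (depth R))))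

  boundR : ∀ {X} → Unique X → Avoids (suc p) (suc q) R X → length X ≤ w * N ^ e
  boundR uX avoidR = ≤-trans (avoiding-bound R typeR 1≤n₁ 1≤n₂ uX avoidR)
    (*-mono-≤ (m≤n⊔m (weight L) (weight R)) (^-monoʳ-≤ N (m≤n⊔m (depth L) (depth R))))

lemma2p10 : (k : ℕ) → ∃[ C ] ((T : WTree) → IsType T → size T ≡ k →
              (n₁ n₂ : ℕ) → 1 ≤ n₁ → 1 ≤ n₂ →
              (S : List ℕ) → Unique S → Avoids n₁ n₂ T S →
              length S ≤ C * (n₁ + n₂) ^ depth T)
lemma2p10 k = k , λ { T typeT refl n₁ n₂ 1≤n₁ 1≤n₂ S u avoid → avoiding-bound T typeT 1≤n₁ 1≤n₂ u avoid }
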